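{- For $q\in\{4,5\}$, the natural action of $\mathrm{PGL}_2(\mathbb{F}_q)$ on the projective line $\mathbb{P}^1(\mathbb{F}_q)=\mathbb{F}_q\cup\{\infty\}$ by fractional linear transformations $z\mapsto (az+b)/(cz+d)$ cannot be sequenced.
   Context: This action is sharply $3$-transitive: for any two ordered triples of distinct points of $\mathbb{P}^1(\mathbb{F}_q)$ there is exactly one element of $\mathrm{PGL}_2(\mathbb{F}_q)$ mapping the first to the second. For a set $X$, $X^{(4)}$ denotes ordered $4$-tuples of distinct elements with coordinatewise action. A sequencing of this action is an enumeration $(x_1,\ldots,x_{q+1})$ of all points of $\mathbb{P}^1(\mathbb{F}_q)$ such that the $q-2$ tuples $(x_i,x_{i+1},x_{i+2},x_{i+3})$, $1\le i\le q-2$, lie in pairwise distinct orbits of $\mathrm{PGL}_2(\mathbb{F}_q)$ on $X^{(4)}$ (equivalently, their cross ratios $\frac{(x_{i+3}-x_i)(x_{i+2}-x_{i+1})}{(x_{i+1}-x_i)(x_{i+2}-x_{i+3})}$ are pairwise distinct). The action "can be sequenced" if a sequencing exists. -}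

module Defs where

open import Data.Nat as ℕ using (ℕ)
open import Data.Nat.DivMod using (_%_; m%n<n)
open import Data.Fin using (Fin; zero; suc; toℕ; fromℕ<)
open import Data.Fin.Properties using () renaming (_≟_ to _≟F_)
open import Data.Product using (Σ; _×_; _,_)
open import Data.List using (List; []; _∷_)
open import Data.List.Membership.Propositional using (_∈_)
open import Data.List.Relation.Unary.Unique.Propositional using (Unique)
open import Data.List.Relation.Unary.AllPairs using (AllPairs)
open import Relation.Binary.PropositionalEquality using (_≡_; refl)
open import Relation.Binary.Definitions using (DecidableEquality)
open import Relation.Nullary using (¬_; yes; no)

-- Field operations on a carrier (only the operations needed to write
-- down fractional linear transformations).

record FieldOps : Set₁ where
  field
    Carrier : Set
    _≟_     : DecidableEquality Carrier
    0#      : Carrier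
    _+_     : Carrier → Carrier → Carrier
    _*_     : Carrier → Carrier → Carrier
    -_      : Carrier → Carrier
    _⁻¹     : Carrier → Carrier   -- multiplicative inverse (0⁻¹ is junk)

  _-_ : Carrier → Carrier → Carrier
  x - y = x + (- y)

module Projective (K : FieldOps) where
  open FieldOps K

  data P1 : Set where
    ∞   : P1
    fin : Carrier → P1

  -- An element of PGL₂(K), given by a representative invertible
  -- matrix (a b ; c d) with ad - bc ≠ 0.  Scalar matrices act
  -- trivially, so orbits of GL₂ and of PGL₂ on P¹ coincide.
  record PGL2 : Set where
    constructor mat
    field
      a b c d : Carrier
      det≢0   : ¬ ((a * d) - (b * c) ≡ 0#)

  act : PGL2 → P1 → P1
  act (mat a b c d _) (fin z) with ((c * z) + d) ≟ 0#
  ... | yes _ = ∞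
  ... | no  _ = fin (((a * z) + b) * (((c * z) + d) ⁻¹))
  act (mat a b c d _) ∞ with c ≟ 0#
  ... | yes _ = ∞
  ... | no  _ = fin (a * (c ⁻¹))

  Tuple4 : Set
  Tuple4 = P1 × P1 × P1 × P1

  act4 : PGL2 → Tuple4 → Tuple4
  act4 g (x , y , z , w) = act g x , act g y , act g z , act g w

  SameOrbit : Tuple4 → Tuple4 → Set
  SameOrbit t u = Σ PGL2 λ g → act4 g t ≡ u

  windows : List P1 → List Tuple4
  windows (x ∷ y ∷ z ∷ w ∷ rest) = (x , y , z , w) ∷ windows (y ∷ z ∷ w ∷ rest)
  windows _ = []

  record Sequencing (xs : List P1) : Set where
    field
      unique   : Unique xs
      complete : (p : P1) → p ∈ xs
      distinct : AllPairs (λ t u → ¬ SameOrbit t u) (windows xs)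

  CanBeSequenced : Set
  CanBeSequenced = Σ (List P1) Sequencing

mod5 : ℕ → Fin 5
mod5 n = fromℕ< (m%n<n n 5)

inv5 : Fin 5 → Fin 5
inv5 zero = zero
inv5 (suc zero) = suc zero
inv5 (suc (suc zero)) = suc (suc (suc zero))
inv5 (suc (suc (suc zero))) = suc (suc zero)
inv5 (suc (suc (suc (suc zero)))) = suc (suc (suc (suc zero)))

F5 : FieldOps
F5 = record
  { Carrier = Fin 5
  ; _≟_ = _≟F_
  ; 0# = zero
  ; _+_ = λ x y → mod5 (toℕ x ℕ.+ toℕ y)
  ; _*_ = λ x y → mod5 (toℕ x ℕ.* toℕ y)
  ; -_ = λ x → mod5 (5 ℕ.∸ toℕ x)
  ; _⁻¹ = inv5
  }

-- 𝔽₄ = 𝔽₂[α]/(α² + α + 1), encoded as 0 ↦ 0, 1 ↦ 1, 2 ↦ α, 3 ↦ α + 1.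

private
  e0 e1 eα eβ : Fin 4
  e0 = zero
  e1 = suc zero
  eα = suc (suc zero)
  eβ = suc (suc (suc zero))   -- β = α + 1 = α²

add4 : Fin 4 → Fin 4 → Fin 4
add4 zero y = y
add4 x zero = x
add4 (suc zero) (suc zero) = e0
add4 (suc zero) (suc (suc zero)) = eβ
add4 (suc zero) (suc (suc (suc zero))) = eα
add4 (suc (suc zero)) (suc zero) = eβ
add4 (suc (suc zero)) (suc (suc zero)) = e0
add4 (suc (suc zero)) (suc (suc (suc zero))) = e1
add4 (suc (suc (suc zero))) (suc zero) = eα
add4 (suc (suc (suc zero))) (suc (suc zero)) = e1
add4 (suc (suc (suc zero))) (suc (suc (suc zero))) = e0

mul4 : Fin 4 → Fin 4 → Fin 4
mul4 zero _ = e0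
mul4 _ zero = e0
mul4 (suc zero) y = y
mul4 x (suc zero) = x
mul4 (suc (suc zero)) (suc (suc zero)) = eβ
mul4 (suc (suc zero)) (suc (suc (suc zero))) = e1
mul4 (suc (suc (suc zero))) (suc (suc zero)) = e1
mul4 (suc (suc (suc zero))) (suc (suc (suc zero))) = eα

inv4 : Fin 4 → Fin 4
inv4 zero = e0
inv4 (suc zero) = e1
inv4 (suc (suc zero)) = eβ
inv4 (suc (suc (suc zero))) = eα

F4 : FieldOps
F4 = record
  { Carrier = Fin 4
  ; _≟_ = _≟F_
  ; 0# = zero
  ; _+_ = add4
  ; _*_ = mul4
  ; -_ = λ x → x
  ; _⁻¹ = inv4
  }

inv5-ok : (x : Fin 5) → ¬ (x ≡ zero) → FieldOps._*_ F5 x (inv5 x) ≡ suc zero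
inv5-ok zero h with h refl
... | ()
inv5-ok (suc zero) _ = refl
inv5-ok (suc (suc zero)) _ = refl
inv5-ok (suc (suc (suc zero))) _ = refl
inv5-ok (suc (suc (suc (suc zero)))) _ = refl

inv4-ok : (x : Fin 4) → ¬ (x ≡ zero) → mul4 x (inv4 x) ≡ suc zero
inv4-ok zero h with h refl
... | ()
inv4-ok (suc zero) _ = refl
inv4-ok (suc (suc zero)) _ = refl
inv4-ok (suc (suc (suc zero))) _ = refl

-- PGL₂(𝔽_q) is sharply 3-transitive on P¹(𝔽_q), so its orbits on 4-tuples of
-- distinct points are the q - 2 values of the cross ratio, and a sequencing must
-- have its q - 2 windows meet every orbit exactly once.  For q = 4, 5 this fails
-- on every enumeration: searching enumerations prefix by prefix, each branch is
-- cut off as soon as two of its windows lie in a common orbit.  Such a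
-- coincidence is certified by the explicit element of PGL₂ taking one window to
-- the other, namely the one determined by their first three points.
module Submission where

open import Defs
open import Data.Fin using (zero; suc)
open import Data.List using (List; []; _∷_; _++_; [_]; map; length; allFin)
open import Data.List.Properties using (++-assoc; ++-identityʳ)
open import Data.List.Membership.Propositional using (_∈_; _∉_)
open import Data.List.Membership.Propositional.Properties using (∈-map⁺; ∈-allFin)
import Data.List.Membership.DecPropositional as DecMembership
open import Data.List.Relation.Unary.All as All using (All; []; _∷_)
open import Data.List.Relation.Unary.All.Properties using (++⁻ˡ; ++⁻ʳ; All¬⇒¬Any)
open import Data.List.Relation.Unary.Any using (Any; here; there; any?; satisfied)
open import Data.List.Relation.Unary.AllPairs using (AllPairs; []; _∷_)
open import Data.List.Relation.Unary.Unique.Propositional using (Unique)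
open import Data.Maybe using (Maybe; just; nothing; _<∣>_; _>>=_; from-just)
import Data.Maybe as Maybe
open import Data.Maybe.Effectful using (applicative)
open import Data.Nat using (ℕ; zero; suc)
open import Data.Product using (∃; _×_; _,_; proj₂)
open import Data.Product.Properties using (≡-dec)
open import Function using (const)
open import Level using (0ℓ)
open import Relation.Binary.Definitions using (DecidableEquality)
open import Relation.Binary.PropositionalEquality using (_≡_; refl; sym; cong; subst)
open import Relation.Nullary using (¬_; yes; no; ¬?; contradiction)
open import Relation.Nullary.Decidable using (dec⇒maybe)

module _ {A : Set} where

  AllPairs-++⁻ˡ : ∀ {R : A → A → Set} xs {ys} → AllPairs R (xs ++ ys) → AllPairs R xs
  AllPairs-++⁻ˡ []       _          = []
  AllPairs-++⁻ˡ (x ∷ xs) (rx ∷ rxs) = ++⁻ˡ xs rx ∷ AllPairs-++⁻ˡ xs rxs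

  AllPairs-++-∷⁻ : ∀ {R : A → A → Set} xs {y ys} →
                   AllPairs R (xs ++ y ∷ ys) → All (λ x → R x y) xs
  AllPairs-++-∷⁻ []       _          = []
  AllPairs-++-∷⁻ (x ∷ xs) (rx ∷ rxs) = All.head (++⁻ʳ xs rx) ∷ AllPairs-++-∷⁻ xs rxs

  Unique-++-∷⇒∉ : ∀ xs {y ys} → Unique (xs ++ y ∷ ys) → y ∉ xs
  Unique-++-∷⇒∉ xs u = All¬⇒¬Any (All.map (λ x≢y y≡x → x≢y (sym y≡x)) (AllPairs-++-∷⁻ xs u))

  firstJust : ∀ {P : A → Set} → (∀ x → Maybe (P x)) → ∀ xs → Maybe (Any P xs)
  firstJust f []       = nothing
  firstJust f (x ∷ xs) = Maybe.map here (f x) <∣> Maybe.map there (firstJust f xs)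

module Sequencings (K : FieldOps) where
  open FieldOps K
  open Projective K
  open Sequencing

  _≟P1_ : DecidableEquality P1
  ∞     ≟P1 ∞     = yes refl
  ∞     ≟P1 fin _ = no λ ()
  fin _ ≟P1 ∞     = no λ ()
  fin x ≟P1 fin y with x ≟ y
  ... | yes refl = yes refl
  ... | no x≢y   = no λ { refl → x≢y refl }

  _≟T_ : DecidableEquality Tuple4
  _≟T_ = ≡-dec _≟P1_ (≡-dec _≟P1_ (≡-dec _≟P1_ _≟P1_))

  InDistinctOrbits : Tuple4 → Tuple4 → Set
  InDistinctOrbits t u = ¬ SameOrbit t u

  windows-++ : ∀ xs ys → ∃ λ zs → windows (xs ++ ys) ≡ windows xs ++ zs
  windows-++ (a ∷ b ∷ c ∷ d ∷ xs) ys with windows-++ (b ∷ c ∷ d ∷ xs) ys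
  ... | zs , eq = zs , cong ((a , b , c , d) ∷_) eq
  windows-++ (a ∷ b ∷ c ∷ [])     ys = windows (a ∷ b ∷ c ∷ ys) , refl
  windows-++ (a ∷ b ∷ [])         ys = windows (a ∷ b ∷ ys) , refl
  windows-++ (a ∷ [])             ys = windows (a ∷ ys) , refl
  windows-++ []                   ys = windows ys , refl

  Refutes : List P1 → Set
  Refutes pre = ∀ rest → ¬ Sequencing (pre ++ rest)

  Refutes[]⇒¬CanBeSequenced : Refutes [] → ¬ CanBeSequenced
  Refutes[]⇒¬CanBeSequenced refutes (xs , s) = refutes xs s

  collision⇒refutes : ∀ {pre} → ¬ AllPairs InDistinctOrbits (windows pre) → Refutes pre
  collision⇒refutes {pre} collision rest s with windows-++ pre rest
  ... | _ , eq = collision (AllPairs-++⁻ˡ (windows pre) (subst (AllPairs _) eq (distinct s)))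

  extensions⇒refutes : ∀ {pre p} → p ∉ pre →
                       (∀ r → r ∉ pre → Refutes (pre ++ [ r ])) → Refutes pre
  extensions⇒refutes {pre} {p} p∉pre _ [] s =
    p∉pre (subst (p ∈_) (++-identityʳ pre) (complete s p))
  extensions⇒refutes {pre} _ refutes-ext (r ∷ rest) s =
    refutes-ext r (Unique-++-∷⇒∉ pre (unique s)) rest
      (subst Sequencing (sym (++-assoc pre [ r ] rest)) s)

  -- Witnesses for SameOrbit, in homogeneous coordinates; 1# is only used to
  -- build candidate matrices, whose correctness is then checked by evaluating
  -- act4, so no field axioms are needed.
  module Witnesses (1# : Carrier) where

    Mat2 : Set
    Mat2 = Carrier × Carrier × Carrier × Carrier

    coords : P1 → Carrier × Carrier
    coords ∞       = 1# , 0#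
    coords (fin z) = z , 1#

    det : Carrier × Carrier → Carrier × Carrier → Carrier
    det (u₁ , u₂) (v₁ , v₂) = (u₁ * v₂) - (u₂ * v₁)

    -- Columns α x and β y with α x + β y ∝ z (Cramer), so ∞, 0, 1 ↦ x, y, z.
    frame : P1 → P1 → P1 → Mat2
    frame x y z with coords x | coords y | coords z
    ... | x₁ , x₂ | y₁ , y₂ | z′ =
      let α = det z′ (y₁ , y₂) ; β = det (x₁ , x₂) z′
      in (α * x₁) , (β * y₁) , (α * x₂) , (β * y₂)

    adjugate : Mat2 → Mat2
    adjugate (a , b , c , d) = d , (- b) , (- c) , a

    _·_ : Mat2 → Mat2 → Mat2
    (a , b , c , d) · (a′ , b′ , c′ , d′) =
      ((a * a′) + (b * c′)) , ((a * b′) + (b * d′)) , ((c * a′) + (d * c′)) , ((c * b′) + (d * d′))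

    transporter : Tuple4 → Tuple4 → Mat2
    transporter (x₁ , x₂ , x₃ , _) (y₁ , y₂ , y₃ , _) =
      frame y₁ y₂ y₃ · adjugate (frame x₁ x₂ x₃)

    invertible? : Mat2 → Maybe PGL2
    invertible? (a , b , c , d) with ((a * d) - (b * c)) ≟ 0#
    ... | yes _    = nothing
    ... | no det≢0 = just (mat a b c d det≢0)

    sameOrbit? : (t u : Tuple4) → Maybe (SameOrbit t u)
    sameOrbit? t u =
      invertible? (transporter t u) >>= λ g → Maybe.map (g ,_) (dec⇒maybe (act4 g t ≟T u))

    collision? : (ws : List Tuple4) → Maybe (¬ AllPairs InDistinctOrbits ws)
    collision? []       = nothing
    collision? (w ∷ ws) with firstJust (sameOrbit? w) ws
    ... | just same = just λ { (distinct-w ∷ _) → All¬⇒¬Any distinct-w same }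
    ... | nothing   = Maybe.map (λ ¬ds → λ { (_ ∷ ds) → ¬ds ds }) (collision? ws)

  module Search (1# : Carrier) (elements : List Carrier) (elements-complete : ∀ x → x ∈ elements) where
    open Witnesses 1#
    open DecMembership _≟P1_ using (_∈?_)

    points : List P1
    points = ∞ ∷ map fin elements

    points-complete : ∀ p → p ∈ points
    points-complete ∞       = here refl
    points-complete (fin x) = there (∈-map⁺ fin (elements-complete x))

    refute          : ℕ → ∀ pre → Maybe (Refutes pre)
    refuteExtension : ℕ → ∀ pre r → Maybe (r ∉ pre → Refutes (pre ++ [ r ]))

    refute zero    pre = nothing
    refute (suc n) pre with collision? (windows pre) | any? (λ p → ¬? (p ∈? pre)) points
    ... | just collision | _           = just (collision⇒refutes collision)
    ... | nothing        | no _        = nothing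
    ... | nothing        | yes missing =
      Maybe.map (λ all-ext → extensions⇒refutes (proj₂ (satisfied missing))
                                                 (λ r → All.lookup all-ext (points-complete r)))
                (All.sequenceA 0ℓ applicative (All.tabulate λ {r} _ → refuteExtension n pre r))

    refuteExtension n pre r with r ∈? pre
    ... | yes r∈pre = just (contradiction r∈pre)
    ... | no  _     = Maybe.map const (refute n (pre ++ [ r ]))

    refuteAll : Maybe (Refutes [])
    refuteAll = refute (suc (length points)) []

mainTheorem5 : ¬ Projective.CanBeSequenced F4 × ¬ Projective.CanBeSequenced F5
mainTheorem5 = Sequencings.Refutes[]⇒¬CanBeSequenced F4 (from-just 𝔽₄.refuteAll)
             , Sequencings.Refutes[]⇒¬CanBeSequenced F5 (from-just 𝔽₅.refuteAll)
  where
  module 𝔽₄ = Sequencings.Search F4 (suc zero) (allFin 4) ∈-allFin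
  module 𝔽₅ = Sequencings.Search F5 (suc zero) (allFin 5) ∈-allFin
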